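{- Let $\mathfrak{M}$ be a class of preference models, $\star$ a dynamic operator and $\mathfrak{D}=\langle\mathfrak{M},\star\rangle$, and suppose the schemata $[\star\varphi][\leq]\xi \to (\varphi\to[\leq](\varphi\to[\star\varphi]\xi))$, $[\star\varphi][<]\xi \to (\varphi\to[<](\varphi\to[\star\varphi]\xi))$, $[\leq][\star\varphi]\xi \to (\varphi\to[\star\varphi][\leq](\varphi\to\xi))$ and $[<][\star\varphi]\xi \to (\varphi\to[\star\varphi][<](\varphi\to\xi))$ are valid in $\mathfrak{D}$ for all $\varphi\in\mathcal{L}_0$, $\xi\in\mathcal{L}_\leq(\star)$. Then for all $\varphi,\psi\in\mathcal{L}_0$ such that $\varphi\to\psi$ is valid in $\mathfrak{D}$, and every $\xi\in\mathcal{L}_\leq(\star)$, the formula $$[\star\psi]B(\xi\mid\varphi)\leftrightarrow B([\star\psi]\xi\mid\varphi)$$ is valid in $\mathfrak{D}$.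
   Context: Fix a set $P$ of propositional letters; $\mathcal{L}_0$ denotes classical propositional formulas over $P$. $\mathcal{L}_\leq$ is generated by $\varphi ::= p \mid \neg\varphi \mid \varphi\wedge\varphi \mid A\varphi \mid [\leq]\varphi \mid [<]\varphi$. A preference model is $M=\langle W,\leq,v\rangle$ with $\leq$ a reflexive transitive relation on the set $W$ whose strict part $<$ is well-founded, and $v:P\to2^W$. A dynamic operator is a map $\star$ from (preference model, formula of $\mathcal{L}_0$) to preference models with $\star(M,\varphi)=\langle W,\leq_{\star\varphi},v\rangle$ (same $W$, $v$). $\mathcal{L}_\leq(\star)$ is the closure of $\mathcal{L}_\leq$ under its constructors and under $[\star\varphi]\xi$. For a dynamic model $D=\langle M,\star\rangle$: $D,w\vDash p$ iff $w\in v(p)$; Booleans as usual; $A\xi$: true at all worlds; $[\leq]\xi$: true at all $w'\leq w$; $[<]\xi$: true at all $w'<w$; $D,w\vDash[\star\varphi]\xi$ iff $\langle\star(M,\varphi),\star\rangle,w\vDash\xi$. $\langle\mathfrak{M},\star\rangle$ is the class of dynamic models $\langle M,\star\rangle$ with $M\in\mathfrak{M}$; validity means truth at every world of every member. Abbreviations: $\langle<\rangle=\neg[<]\neg$, $\mu\xi:=\xi\wedge\neg\langle<\rangle\xi$, $B(\psi\mid\varphi):=A(\mu\varphi\to\psi)$. -}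

module Defs where

open import Level using (0ℓ)
open import Data.Product using (_×_)
open import Relation.Nullary using (¬_)
open import Relation.Binary.Core using (Rel)
open import Induction.WellFounded using (WellFounded)

Strict : {W : Set} → Rel W 0ℓ → Rel W 0ℓ
Strict _≤_ u w = u ≤ w × ¬ (w ≤ u)

record PrefOrder (W : Set) : Set₁ where
  field
    _≤_    : Rel W 0ℓ
    refl≤  : ∀ {w} → w ≤ w
    trans≤ : ∀ {u v w} → u ≤ v → v ≤ w → u ≤ w
    wf     : WellFounded (Strict _≤_)

record PrefModel (P : Set) : Set₁ where
  field
    W     : Set
    order : PrefOrder W
    val   : P → W → Set
open PrefModel public

data Form0 (P : Set) : Set where
  var0 : P → Form0 P
  neg0 : Form0 P → Form0 P
  and0 : Form0 P → Form0 P → Form0 P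

data Form (P : Set) : Set where
  var  : P → Form P
  ~_   : Form P → Form P
  _∧_  : Form P → Form P → Form P
  A    : Form P → Form P
  [≤]  : Form P → Form P
  [<]  : Form P → Form P
  [⋆_]_ : Form0 P → Form P → Form P

infixr 6 _∧_
infix 7 ~_

emb : {P : Set} → Form0 P → Form P
emb (var0 p)   = var p
emb (neg0 φ)   = ~ emb φ
emb (and0 φ ψ) = emb φ ∧ emb ψ

_⇒_ : {P : Set} → Form P → Form P → Form P
a ⇒ b = ~ (a ∧ ~ b)

_⇔_ : {P : Set} → Form P → Form P → Form P
a ⇔ b = (a ⇒ b) ∧ (b ⇒ a)

infixr 4 _⇒_
infix 3 _⇔_

⟨<⟩ : {P : Set} → Form P → Form P
⟨<⟩ ξ = ~ [<] (~ ξ)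

μ : {P : Set} → Form P → Form P
μ ξ = ξ ∧ ~ ⟨<⟩ ξ

B : {P : Set} → Form P → Form P → Form P
B ψ φ = A (μ φ ⇒ ψ)

DynOp : Set → Set₁
DynOp P = (M : PrefModel P) → Form0 P → PrefOrder (W M)

update : {P : Set} → DynOp P → PrefModel P → Form0 P → PrefModel P
update ⋆ M φ = record { W = W M ; order = ⋆ M φ ; val = val M }

sat : {P : Set} → DynOp P → (M : PrefModel P) → W M → Form P → Set
sat ⋆ M w (var p)    = val M p w
sat ⋆ M w (~ ξ)      = ¬ sat ⋆ M w ξ
sat ⋆ M w (ξ ∧ χ)    = sat ⋆ M w ξ × sat ⋆ M w χ
sat ⋆ M w (A ξ)      = ∀ w' → sat ⋆ M w' ξ
sat ⋆ M w ([≤] ξ)    = ∀ w' → PrefOrder._≤_ (order M) w' w → sat ⋆ M w' ξ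
sat ⋆ M w ([<] ξ)    = ∀ w' → Strict (PrefOrder._≤_ (order M)) w' w → sat ⋆ M w' ξ
sat ⋆ M w ([⋆ φ ] ξ) = sat ⋆ (update ⋆ M φ) w ξ

Valid : {P : Set} → (PrefModel P → Set₁) → DynOp P → Form P → Set₁
Valid 𝔐 ⋆ ξ = ∀ (M : PrefModel _) → 𝔐 M → ∀ (w : W M) → sat ⋆ M w ξ

-- Formulas of 𝓛₀ are evaluated through the valuation alone, which an update leaves
-- unchanged.  Both sides of the equivalence therefore say that ξ holds after the
-- ψ-update at every most plausible φ-world; they differ only in whether "most
-- plausible" is read in the updated order or in the original one.  Instantiated with
-- ξ := ¬φ, the two strict schemata say that a φ-world (hence a ψ-world) has no
-- strictly better φ-world after the update iff it has none before, so both readings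
-- select the same worlds.
module Submission where

open import Defs
open import Data.Product using (_×_; _,_)
open import Function.Base using (id; _∘_)
open import Relation.Binary.PropositionalEquality using (_≡_; refl; cong; cong₂; subst; sym)
open import Relation.Nullary using (¬_)
open import Relation.Nullary.Negation using (¬¬-map)

-- Semantically: on ψ-worlds, the update ⋆ψ preserves (resp. reflects) the strict order.
Preserves< : {P : Set} → (PrefModel P → Set₁) → DynOp P → Set₁
Preserves< 𝔐 ⋆ = ∀ φ ξ → Valid 𝔐 ⋆ ([⋆ φ ] [<] ξ ⇒ (emb φ ⇒ [<] (emb φ ⇒ [⋆ φ ] ξ)))

Reflects< : {P : Set} → (PrefModel P → Set₁) → DynOp P → Set₁
Reflects< 𝔐 ⋆ = ∀ φ ξ → Valid 𝔐 ⋆ ([<] ([⋆ φ ] ξ) ⇒ (emb φ ⇒ [⋆ φ ] [<] (emb φ ⇒ ξ)))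

-- sat ⋆ M w (a ⇒ b) unfolds to ¬ (sat ⋆ M w a × ¬ sat ⋆ M w b).
⇒-elim : {A B : Set} → ¬ (A × ¬ B) → A → ¬ ¬ B
⇒-elim a⇒b a ¬b = a⇒b (a , ¬b)

module _ {P : Set} (⋆ : DynOp P) where

  sat-emb-update : ∀ M ψ w (φ : Form0 P) → sat ⋆ (update ⋆ M ψ) w (emb φ) ≡ sat ⋆ M w (emb φ)
  sat-emb-update M ψ w (var0 p)   = refl
  sat-emb-update M ψ w (neg0 φ)   = cong ¬_ (sat-emb-update M ψ w φ)
  sat-emb-update M ψ w (and0 φ χ) = cong₂ _×_ (sat-emb-update M ψ w φ) (sat-emb-update M ψ w χ)

  sat-emb-from-update : ∀ {M ψ w} (φ : Form0 P) → sat ⋆ (update ⋆ M ψ) w (emb φ) → sat ⋆ M w (emb φ)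
  sat-emb-from-update {M} {ψ} {w} φ = subst id (sat-emb-update M ψ w φ)

  sat-emb-to-update : ∀ {M ψ w} (φ : Form0 P) → sat ⋆ M w (emb φ) → sat ⋆ (update ⋆ M ψ) w (emb φ)
  sat-emb-to-update {M} {ψ} {w} φ = subst id (sym (sat-emb-update M ψ w φ))

  [⋆]-B-comm : ∀ M ψ (χ ξ : Form P) w
    → (∀ {v} → sat ⋆ (update ⋆ M ψ) v (μ χ) → sat ⋆ M v (μ χ))
    → (∀ {v} → sat ⋆ M v (μ χ) → sat ⋆ (update ⋆ M ψ) v (μ χ))
    → sat ⋆ M w ([⋆ ψ ] B ξ χ ⇔ B ([⋆ ψ ] ξ) χ)
  [⋆]-B-comm M ψ χ ξ w μ-from-update μ-to-update =
      (λ (before , ¬after) → ¬after λ v (μv , ¬ξv) → before v (μ-to-update μv , ¬ξv))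
    , (λ (after , ¬before) → ¬before λ v (μv , ¬ξv) → after v (μ-from-update μv , ¬ξv))

module _ {P : Set} {𝔐 : PrefModel P → Set₁} {⋆ : DynOp P} (φ ψ : Form0 P)
         (φ⇒ψ : Valid 𝔐 ⋆ (emb φ ⇒ emb ψ)) (M : PrefModel P) (m : 𝔐 M) {v : W M} where

  private
    M' = update ⋆ M ψ

  [<]¬φ-from-update : Preserves< 𝔐 ⋆ → sat ⋆ M v (emb φ)
    → sat ⋆ M' v ([<] (~ emb φ)) → sat ⋆ M v ([<] (~ emb φ))
  [<]¬φ-from-update preserves φv none-after u u<v φu =
    ⇒-elim (φ⇒ψ M m v) φv λ ψv →
    ⇒-elim (φ⇒ψ M m u) φu λ ψu →
    ⇒-elim (preserves ψ (~ emb φ) M m v) none-after λ ψ⇒none →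
    ⇒-elim ψ⇒none ψv λ none →
    ⇒-elim (none u u<v) ψu λ ¬φu-after → ¬φu-after (sat-emb-to-update ⋆ φ φu)

  [<]¬φ-to-update : Reflects< 𝔐 ⋆ → sat ⋆ M v (emb φ)
    → sat ⋆ M v ([<] (~ emb φ)) → sat ⋆ M' v ([<] (~ emb φ))
  [<]¬φ-to-update reflects φv none u u<v φu-after =
    ⇒-elim (φ⇒ψ M m v) φv λ ψv →
    ⇒-elim (φ⇒ψ M m u) φu λ ψu →
    ⇒-elim (reflects ψ (~ emb φ) M m v) (λ w w<v → none w w<v ∘ sat-emb-from-update ⋆ φ)
      λ ψ⇒none-after →
    ⇒-elim ψ⇒none-after ψv λ none-after →
    ⇒-elim (none-after u u<v) (sat-emb-to-update ⋆ ψ ψu) λ ¬φu → ¬φu φu-after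
    where φu = sat-emb-from-update ⋆ φ φu-after

  μφ-from-update : Preserves< 𝔐 ⋆ → sat ⋆ M' v (μ (emb φ)) → sat ⋆ M v (μ (emb φ))
  μφ-from-update preserves (φv-after , minimal-after) =
    φv , ¬¬-map ([<]¬φ-from-update preserves φv) minimal-after
    where φv = sat-emb-from-update ⋆ φ φv-after

  μφ-to-update : Reflects< 𝔐 ⋆ → sat ⋆ M v (μ (emb φ)) → sat ⋆ M' v (μ (emb φ))
  μφ-to-update reflects (φv , minimal) =
    sat-emb-to-update ⋆ φ φv , ¬¬-map ([<]¬φ-to-update reflects φv) minimal

proposition24 : {P : Set} (𝔐 : PrefModel P → Set₁) (⋆ : DynOp P)
    → (∀ (φ : Form0 P) (ξ : Form P) → Valid 𝔐 ⋆ ([⋆ φ ] [≤] ξ ⇒ (emb φ ⇒ [≤] (emb φ ⇒ [⋆ φ ] ξ))))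
    → (∀ (φ : Form0 P) (ξ : Form P) → Valid 𝔐 ⋆ ([⋆ φ ] [<] ξ ⇒ (emb φ ⇒ [<] (emb φ ⇒ [⋆ φ ] ξ))))
    → (∀ (φ : Form0 P) (ξ : Form P) → Valid 𝔐 ⋆ ([≤] ([⋆ φ ] ξ) ⇒ (emb φ ⇒ [⋆ φ ] [≤] (emb φ ⇒ ξ))))
    → (∀ (φ : Form0 P) (ξ : Form P) → Valid 𝔐 ⋆ ([<] ([⋆ φ ] ξ) ⇒ (emb φ ⇒ [⋆ φ ] [<] (emb φ ⇒ ξ))))
    → ∀ (φ ψ : Form0 P) → Valid 𝔐 ⋆ (emb φ ⇒ emb ψ)
    → ∀ (ξ : Form P) → Valid 𝔐 ⋆ ([⋆ ψ ] B ξ (emb φ) ⇔ B ([⋆ ψ ] ξ) (emb φ))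
proposition24 𝔐 ⋆ _ preserves _ reflects φ ψ φ⇒ψ ξ M m w =
  [⋆]-B-comm ⋆ M ψ (emb φ) ξ w
    (μφ-from-update φ ψ φ⇒ψ M m preserves)
    (μφ-to-update φ ψ φ⇒ψ M m reflects)
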